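{- Let $t,n\geq 1$ be integers and $N=tn$. Partition $[N]=\{1,\dots,N\}$ into consecutive intervals $I_1,\dots,I_n$ each of length $t$. For an $n\times n$ $0$-$1$ matrix $B$, let $\mathcal{L}_t(B)$ be the set of $N\times N$ permutation matrices $A$ whose support (set of positions of ones) is contained in the union of the blocks $I_a\times I_b$ over all pairs $(a,b)$ with $B_{a,b}=1$. Then for every $n\times n$ $0$-$1$ matrix $B$, \[ |\mathcal{L}_t(B)| \leq (t!)^n\left(\frac{|B|}{n}\right)^N, \] where $|B|$ denotes the number of ones in $B$. -}

module Defs where

open import Data.Nat using (ℕ; zero; suc; _+_; _*_)
open import Data.Bool using (Bool; true; false; if_then_else_)
open import Data.Fin using (Fin; zero; suc; quotient; _≟_)
open import Data.Fin.Properties using (all?)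
open import Data.List using (List; []; _∷_; map; concatMap; filter; length; allFin)
open import Data.Nat.ListAction using (sum)
open import Data.Product using (_×_)
open import Relation.Binary.PropositionalEquality using (_≡_)
open import Relation.Nullary using (Dec)
open import Relation.Nullary.Decidable using (_→-dec_; _×-dec_)
open import Data.Bool.Properties using () renaming (_≟_ to _≟ᵇ_)

Matrix01 : ℕ → Set
Matrix01 n = Fin n → Fin n → Bool

ones : ∀ {n} → Matrix01 n → ℕ
ones {n} B = sum (map (λ a → sum (map (λ b → if B a b then 1 else 0) (allFin n))) (allFin n))

cons : ∀ {m k} → Fin k → (Fin m → Fin k) → Fin (suc m) → Fin k
cons c f zero    = c
cons c f (suc i) = f i

allFuns : (m k : ℕ) → List (Fin m → Fin k)
allFuns zero    k = (λ ()) ∷ []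
allFuns (suc m) k = concatMap (λ f → map (λ c → cons c f) (allFin k)) (allFuns m k)

-- A permutation of Fin N (equivalently an N×N permutation matrix A with
-- A i j = 1 iff σ i = j): an injective self-map of Fin N.
IsPerm : ∀ {N} → (Fin N → Fin N) → Set
IsPerm {N} σ = ∀ i j → σ i ≡ σ j → i ≡ j

isPerm? : ∀ {N} (σ : Fin N → Fin N) → Dec (IsPerm σ)
isPerm? σ = all? (λ i → all? (λ j → (σ i ≟ σ j) →-dec (i ≟ j)))

-- [N] with N = n * t (0-indexed) is partitioned into n consecutive intervals
-- of length t; position i lies in interval  quotient t i = ⌊ i / t ⌋.
Supported : ∀ t n → Matrix01 n → (Fin (n * t) → Fin (n * t)) → Set
Supported t n B σ = ∀ i → B (quotient t i) (quotient t (σ i)) ≡ true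

supported? : ∀ t n (B : Matrix01 n) (σ : Fin (n * t) → Fin (n * t)) → Dec (Supported t n B σ)
supported? t n B σ = all? (λ i → B (quotient t i) (quotient t (σ i)) ≟ᵇ true)

Lcount : ∀ t n → Matrix01 n → ℕ
Lcount t n B = length (filter (λ σ → isPerm? σ ×-dec supported? t n B σ) (allFuns (n * t) (n * t)))

module Submission where

-- Place the rows of the permutation one at a time. Call the columns of the
-- j-th interval block j. If block b still has f_b unused columns and row i may
-- only go to the blocks in a set A_i, then there are at most
-- ∏_b f_b! · ∏_i |A_i| ways to place the remaining rows injectively. This is
-- proved by induction: the first row goes to an allowed block b in at most f_b
-- ways, and f_b · (f_b − 1)! = f_b!. For L_t(B), every f_b starts at t and
-- each of the t rows of block row a has |A_i| = |B_a|, the number of ones in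
-- row a of B. Hence |L_t(B)| ≤ (t!)^n ∏_a |B_a|^t, and AM–GM in the
-- division-free form n^n ∏_a |B_a| ≤ (∑_a |B_a|)^n = |B|^n finishes the proof.

open import Defs
open import Algebra.Bundles using (CommutativeMonoid)
open import Data.Bool using (Bool; true; false; not; if_then_else_)
open import Data.Fin using (Fin; zero; suc; _↑ˡ_; _↑ʳ_; quotient)
open import Data.Fin.Properties using (splitAt-↑ˡ; splitAt-↑ʳ; suc-injective; any?; _≟_)
open import Data.List using (List; []; _∷_; _++_; map; concatMap; filter; length; tabulate; allFin)
open import Data.List.Properties using (map-++; map-cong; map-∘; map-tabulate)
open import Data.Nat using (ℕ; zero; suc; _+_; _*_; _∸_; _^_; _≤_; z≤n; _!; _≤?_)
import Data.Nat.ListAction as List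
open import Data.Nat.ListAction.Properties using (sum-++)
open import Data.Nat.Properties
  using ( +-assoc; +-comm; +-identityʳ; *-assoc; *-comm; *-identityʳ; *-zeroʳ; *-distribˡ-+
        ; ≤-refl; ≤-trans; ≤-reflexive; +-mono-≤; +-monoʳ-≤; *-mono-≤; *-monoˡ-≤; *-monoʳ-≤
        ; +-mono-<-≤; +-cancelˡ-≤; m≤m+n; m≤n+m; m≤n⇒m≤o+n; ≰⇒≥; ≰⇒>; <⇒≱; <⇒≤
        ; m+[n∸m]≡n; +-∸-assoc; m+n∸n≡m; ∸-monoˡ-≤; ^-zeroˡ; ^-*-assoc; ^-monoˡ-≤; 1≤n!
        ; +-*-semiring; +-0-commutativeMonoid; *-1-commutativeMonoid; *-commutativeSemigroup
        ; module ≤-Reasoning )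
open import Data.Product using (_×_; _,_)
open import Data.Sum using (_⊎_; inj₁; inj₂)
open import Data.Vec.Functional using (Vector; head; tail; replicate; updateAt)
open import Data.Vec.Functional.Properties using (updateAt-updates; updateAt-minimal; updateAt-id)
open import Function using (_∘_; id; const)
open import Relation.Binary.PropositionalEquality
  using (_≡_; _≢_; refl; sym; trans; cong; cong₂; subst; module ≡-Reasoning)
open import Relation.Nullary using (Dec; does; yes; no; contradiction)
open import Relation.Nullary.Decidable using (_×-dec_; _⊎-dec_)

quotient-↑ˡ : ∀ {n} t (i : Fin t) → quotient {suc n} t (i ↑ˡ (n * t)) ≡ zero
quotient-↑ˡ {n} t i rewrite splitAt-↑ˡ t i (n * t) = refl

quotient-↑ʳ : ∀ {n} t (j : Fin (n * t)) → quotient {suc n} t (t ↑ʳ j) ≡ suc (quotient t j)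
quotient-↑ʳ {n} t j rewrite splitAt-↑ʳ t (n * t) j = refl

module CommutativeMonoidSum {c ℓ} (M : CommutativeMonoid c ℓ) where
  open CommutativeMonoid M renaming (sym to ≈-sym; trans to ≈-trans; setoid to ≈-setoid)
  open import Algebra.Properties.CommutativeMonoid.Sum M
    using (sum; sum-cong-≗; sum-cong-≋; sum-replicate-zero; ∑-distrib-+)
  open import Algebra.Properties.CommutativeSemigroup commutativeSemigroup using (x∙yz≈y∙xz)
  open import Relation.Binary.Reasoning.Setoid ≈-setoid

  sum-exchange : ∀ {n} {f g : Vector Carrier n} i → (∀ j → j ≢ i → f j ≈ g j) →
                 sum f ∙ g i ≈ f i ∙ sum g
  sum-exchange {f = f} {g} zero f≈g = begin
    f zero ∙ sum (tail f) ∙ g zero   ≈⟨ assoc _ _ _ ⟩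
    f zero ∙ (sum (tail f) ∙ g zero) ≈⟨ ∙-congˡ (comm _ _) ⟩
    f zero ∙ (g zero ∙ sum (tail f)) ≈⟨ ∙-congˡ (∙-congˡ (sum-cong-≋ (λ j → f≈g (suc j) λ ()))) ⟩
    f zero ∙ sum g                   ∎
  sum-exchange {f = f} {g} (suc i) f≈g = begin
    f zero ∙ sum (tail f) ∙ g (suc i)   ≈⟨ assoc _ _ _ ⟩
    f zero ∙ (sum (tail f) ∙ g (suc i)) ≈⟨ ∙-congˡ (sum-exchange i (λ j j≢i → f≈g (suc j) (j≢i ∘ suc-injective))) ⟩
    f zero ∙ (f (suc i) ∙ sum (tail g)) ≈⟨ x∙yz≈y∙xz _ _ _ ⟩
    f (suc i) ∙ (f zero ∙ sum (tail g)) ≈⟨ ∙-congˡ (∙-congʳ (f≈g zero λ ())) ⟩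
    f (suc i) ∙ sum g                   ∎

  sum-updateAt : ∀ {n} (g : Vector Carrier n) i h →
                 sum (updateAt g i h) ≈ h (g i) ∙ sum (updateAt g i (const ε))
  sum-updateAt g i h = begin
    sum (updateAt g i h)                            ≈⟨ ≈-sym (identityʳ _) ⟩
    sum (updateAt g i h) ∙ ε                        ≡⟨ cong (sum (updateAt g i h) ∙_) (sym (updateAt-updates i g)) ⟩
    sum (updateAt g i h) ∙ updateAt g i (const ε) i ≈⟨ sum-exchange i agree ⟩
    updateAt g i h i ∙ sum (updateAt g i (const ε)) ≡⟨ cong (_∙ _) (updateAt-updates i g) ⟩
    h (g i) ∙ sum (updateAt g i (const ε))          ∎
    where
    agree : ∀ j → j ≢ i → updateAt g i h j ≈ updateAt g i (const ε) j
    agree j j≢i = reflexive (trans (updateAt-minimal j i g j≢i) (sym (updateAt-minimal j i g j≢i)))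

  sum-↑ˡ-↑ʳ : ∀ m {n} (f : Vector Carrier (m + n)) →
              sum f ≈ sum (f ∘ (_↑ˡ n)) ∙ sum (f ∘ (m ↑ʳ_))
  sum-↑ˡ-↑ʳ zero    f = ≈-sym (identityˡ _)
  sum-↑ˡ-↑ʳ (suc m) f = ≈-trans (∙-congˡ (sum-↑ˡ-↑ʳ m (f ∘ suc))) (≈-sym (assoc _ _ _))

  sum-quotient : ∀ n t (h : Vector Carrier n) →
                 sum {n * t} (h ∘ quotient t) ≈ sum (replicate t (sum h))
  sum-quotient zero    t h = ≈-sym (sum-replicate-zero t)
  sum-quotient (suc n) t h = begin
    sum (h ∘ quotient t)                                          ≈⟨ sum-↑ˡ-↑ʳ t (h ∘ quotient t) ⟩
    sum (h ∘ quotient t ∘ (_↑ˡ n * t)) ∙ sum (h ∘ quotient t ∘ (t ↑ʳ_))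
      ≡⟨ cong₂ _∙_ (sum-cong-≗ (cong h ∘ quotient-↑ˡ t)) (sum-cong-≗ (cong h ∘ quotient-↑ʳ t)) ⟩
    sum (replicate t (h zero)) ∙ sum (tail h ∘ quotient t)        ≈⟨ ∙-congˡ (sum-quotient n t (tail h)) ⟩
    sum (replicate t (h zero)) ∙ sum (replicate t (sum (tail h))) ≈⟨ ≈-sym (∑-distrib-+ (replicate t (h zero)) _) ⟩
    sum (replicate t (sum h))                                     ∎

open import Algebra.Properties.Semiring.Sum +-*-semiring
  using (sum-syntax; ∑-comm; ∑-distrib-+; *-distribˡ-sum; *-distribʳ-sum; sum-replicate-zero)
  renaming (sum to ∑; sum-cong-≗ to ∑-cong)
open import Algebra.Properties.CommutativeMonoid.Sum *-1-commutativeMonoid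
  using () renaming (sum to ∏; sum-cong-≗ to ∏-cong; ∑-distrib-+ to ∏-distrib-*)
open CommutativeMonoidSum +-0-commutativeMonoid
  using () renaming (sum-exchange to ∑-exchange; sum-updateAt to ∑-updateAt; sum-quotient to ∑-quotient)
open CommutativeMonoidSum *-1-commutativeMonoid
  using () renaming (sum-updateAt to ∏-updateAt; sum-quotient to ∏-quotient)
open import Algebra.Properties.CommutativeSemigroup *-commutativeSemigroup
  using (x∙yz≈y∙xz; x∙yz≈z∙yx; xy∙z≈zx∙y; interchange)

^-distribʳ-* : ∀ m n o → (m * n) ^ o ≡ m ^ o * n ^ o
^-distribʳ-* m n zero    = refl
^-distribʳ-* m n (suc o) = trans (cong (m * n *_) (^-distribʳ-* m n o)) (interchange m n (m ^ o) (n ^ o))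

∑-replicate : ∀ n x → ∑ (replicate n x) ≡ n * x
∑-replicate zero    x = refl
∑-replicate (suc n) x = cong (x +_) (∑-replicate n x)

∏-replicate : ∀ n x → ∏ (replicate n x) ≡ x ^ n
∏-replicate zero    x = refl
∏-replicate (suc n) x = cong (x *_) (∏-replicate n x)

∑-mono-≤ : ∀ {n} {f g : Vector ℕ n} → (∀ i → f i ≤ g i) → ∑ f ≤ ∑ g
∑-mono-≤ {zero}  f≤g = z≤n
∑-mono-≤ {suc n} f≤g = +-mono-≤ (f≤g zero) (∑-mono-≤ (f≤g ∘ suc))

∏-mono-≤ : ∀ {n} {f g : Vector ℕ n} → (∀ i → f i ≤ g i) → ∏ f ≤ ∏ g
∏-mono-≤ {zero}  f≤g = ≤-refl
∏-mono-≤ {suc n} f≤g = *-mono-≤ (f≤g zero) (∏-mono-≤ (f≤g ∘ suc))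

𝟙 : Bool → ℕ
𝟙 b = if b then 1 else 0

∣_∣ : ∀ {n} → (Fin n → Bool) → ℕ
∣_∣ {n} r = ∑[ b < n ] 𝟙 (r b)

δ : ∀ {n} → Fin n → Fin n → ℕ
δ a b = 𝟙 (does (a ≟ b))

∑-δˡ : ∀ {n} (b : Fin n) (h : Vector ℕ n) → ∑[ a < n ] (δ a b * h a) ≡ h b
∑-δˡ {suc n} zero    h = trans (cong₂ _+_ (+-identityʳ (h zero)) (sum-replicate-zero n)) (+-identityʳ _)
∑-δˡ {suc n} (suc b) h = ∑-δˡ b (tail h)

∑-δʳ : ∀ {n} (a : Fin n) (h : Vector ℕ n) → ∑[ b < n ] (δ a b * h b) ≡ h a
∑-δʳ {suc n} zero    h = trans (cong₂ _+_ (+-identityʳ (h zero)) (sum-replicate-zero n)) (+-identityʳ _)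
∑-δʳ {suc n} (suc a) h = ∑-δʳ a (tail h)

∑-fibre : ∀ {k n} (β : Fin k → Fin n) (w : Vector ℕ k) (h : Vector ℕ n) →
          ∑[ c < k ] (w c * h (β c)) ≡ ∑[ b < n ] (h b * ∑[ c < k ] (δ (β c) b * w c))
∑-fibre {k} {n} β w h = begin
  ∑[ c < k ] (w c * h (β c))                      ≡⟨ ∑-cong (λ c → cong (w c *_) (∑-δʳ (β c) h)) ⟨
  ∑[ c < k ] (w c * ∑[ b < n ] (δ (β c) b * h b)) ≡⟨ ∑-cong (λ c → *-distribˡ-sum (w c) (λ b → δ (β c) b * h b)) ⟩
  ∑[ c < k ] ∑[ b < n ] (w c * (δ (β c) b * h b)) ≡⟨ ∑-comm (λ c b → w c * (δ (β c) b * h b)) ⟩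
  ∑[ b < n ] ∑[ c < k ] (w c * (δ (β c) b * h b)) ≡⟨ ∑-cong (λ b → ∑-cong (λ c → x∙yz≈z∙yx (w c) (δ (β c) b) (h b))) ⟩
  ∑[ b < n ] ∑[ c < k ] (h b * (δ (β c) b * w c)) ≡⟨ ∑-cong (λ b → *-distribˡ-sum (h b) (λ c → δ (β c) b * w c)) ⟨
  ∑[ b < n ] (h b * ∑[ c < k ] (δ (β c) b * w c)) ∎
  where open ≡-Reasoning

decrementAt : ∀ {n} → Vector ℕ n → Fin n → Vector ℕ n
decrementAt cap b b′ = cap b′ ∸ δ b b′

n*[n∸1]!≤n! : ∀ n → n * (n ∸ 1) ! ≤ n !
n*[n∸1]!≤n! zero    = z≤n
n*[n∸1]!≤n! (suc n) = ≤-refl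

*-∏!-decrementAt≤∏! : ∀ {n} (cap : Vector ℕ n) b → cap b * ∏ (_! ∘ decrementAt cap b) ≤ ∏ (_! ∘ cap)
*-∏!-decrementAt≤∏! cap zero    = begin
  cap zero * ((cap zero ∸ 1) ! * P) ≡⟨ *-assoc (cap zero) _ P ⟨
  cap zero * (cap zero ∸ 1) ! * P   ≤⟨ *-monoˡ-≤ P (n*[n∸1]!≤n! (cap zero)) ⟩
  cap zero ! * P                    ∎
  where
  open ≤-Reasoning
  P = ∏ (_! ∘ tail cap)
*-∏!-decrementAt≤∏! cap (suc b) = begin
  cap (suc b) * (cap zero ! * Q) ≡⟨ x∙yz≈y∙xz (cap (suc b)) (cap zero !) Q ⟩
  cap zero ! * (cap (suc b) * Q) ≤⟨ *-monoʳ-≤ (cap zero !) (*-∏!-decrementAt≤∏! (tail cap) b) ⟩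
  ∏ (_! ∘ cap)                   ∎
  where
  open ≤-Reasoning
  Q = ∏ (_! ∘ decrementAt (tail cap) b)

Between : ℕ → ℕ → ℕ → Set
Between M x y = x ≤ M × M ≤ y ⊎ y ≤ M × M ≤ x

between? : ∀ M x y → Dec (Between M x y)
between? M x y = (x ≤? M ×-dec M ≤? y) ⊎-dec (y ≤? M ×-dec M ≤? x)

between⇒≤+ : ∀ {M x y} → Between M x y → M ≤ x + y
between⇒≤+ {x = x} {y} (inj₁ (_ , M≤y)) = ≤-trans M≤y (m≤n+m y x)
between⇒≤+ {x = x} {y} (inj₂ (_ , M≤x)) = ≤-trans M≤x (m≤m+n x y)

between⇒*≤* : ∀ {M x y} → Between M x y → x * y ≤ M * (x + y ∸ M)
between⇒*≤* {M} {x} {y} (inj₁ (x≤M , M≤y)) = begin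
  x * y               ≡⟨ cong (x *_) (m+[n∸m]≡n M≤y) ⟨
  x * (M + (y ∸ M))   ≡⟨ *-distribˡ-+ x M (y ∸ M) ⟩
  x * M + x * (y ∸ M) ≤⟨ +-monoʳ-≤ (x * M) (*-monoˡ-≤ (y ∸ M) x≤M) ⟩
  x * M + M * (y ∸ M) ≡⟨ cong (_+ M * (y ∸ M)) (*-comm x M) ⟩
  M * x + M * (y ∸ M) ≡⟨ *-distribˡ-+ M x (y ∸ M) ⟨
  M * (x + (y ∸ M))   ≡⟨ cong (M *_) (+-∸-assoc x M≤y) ⟨
  M * (x + y ∸ M)     ∎
  where open ≤-Reasoning
between⇒*≤* {M} {x} {y} (inj₂ y≤M,M≤x) = begin
  x * y           ≡⟨ *-comm x y ⟩
  y * x           ≤⟨ between⇒*≤* (inj₁ y≤M,M≤x) ⟩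
  M * (y + x ∸ M) ≡⟨ cong (λ z → M * (z ∸ M)) (+-comm y x) ⟩
  M * (x + y ∸ M) ∎
  where open ≤-Reasoning

∑-smooth : ∀ {M x n} (g : Vector ℕ n) j → Between M x (g j) →
           M + ∑ (updateAt g j (λ y → x + y ∸ M)) ≡ x + ∑ g
∑-smooth {M} {x} g j x⋈gⱼ = begin
  M + ∑ (updateAt g j (λ y → x + y ∸ M)) ≡⟨ cong (M +_) (∑-updateAt g j _) ⟩
  M + ((x + g j ∸ M) + S)                ≡⟨ +-assoc M _ S ⟨
  (M + (x + g j ∸ M)) + S                ≡⟨ cong (_+ S) (m+[n∸m]≡n (between⇒≤+ x⋈gⱼ)) ⟩
  (x + g j) + S                          ≡⟨ +-assoc x (g j) S ⟩
  x + (g j + S)                          ≡⟨ cong (x +_) (trans (∑-cong (sym ∘ updateAt-id j g)) (∑-updateAt g j id)) ⟨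
  x + ∑ g                                ∎
  where
  open ≡-Reasoning
  S = ∑ (updateAt g j (const 0))

∏-smooth : ∀ {M x n} (g : Vector ℕ n) j → Between M x (g j) →
           x * ∏ g ≤ M * ∏ (updateAt g j (λ y → x + y ∸ M))
∏-smooth {M} {x} g j x⋈gⱼ = begin
  x * ∏ g                 ≡⟨ cong (x *_) (trans (∏-cong (sym ∘ updateAt-id j g)) (∏-updateAt g j id)) ⟩
  x * (g j * R)           ≡⟨ *-assoc x (g j) R ⟨
  (x * g j) * R           ≤⟨ *-monoˡ-≤ R (between⇒*≤* x⋈gⱼ) ⟩
  M * (x + g j ∸ M) * R   ≡⟨ *-assoc M _ R ⟩
  M * ((x + g j ∸ M) * R) ≡⟨ cong (M *_) (∏-updateAt g j _) ⟨
  M * ∏ (updateAt g j (λ y → x + y ∸ M)) ∎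
  where
  open ≤-Reasoning
  R = ∏ (updateAt g j (const 1))

-- If some later entry lies on the other side of M from the head x, smoothing
-- the pair to (M , x + y ∸ M) lets the induction hypothesis apply to the tail.
-- Otherwise all entries are ≤ M, or all are > M, contradicting ∑ f ≤ n * M.
am-gm : ∀ {n} (f : Vector ℕ n) M → ∑ f ≤ n * M → ∏ f ≤ M ^ n
am-gm {zero}  f M _ = ≤-refl
am-gm {suc n} f M ∑f≤ with any? (λ j → between? M (head f) (tail f j))
... | yes (j , x⋈gⱼ) = begin
  head f * ∏ (tail f) ≤⟨ ∏-smooth (tail f) j x⋈gⱼ ⟩
  M * ∏ g′            ≤⟨ *-monoʳ-≤ M (am-gm g′ M (+-cancelˡ-≤ M _ _ M+∑g′≤)) ⟩
  M * M ^ n           ∎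
  where
  open ≤-Reasoning
  g′ = updateAt (tail f) j (λ y → head f + y ∸ M)
  M+∑g′≤ : M + ∑ g′ ≤ M + n * M
  M+∑g′≤ = subst (_≤ M + n * M) (sym (∑-smooth (tail f) j x⋈gⱼ)) ∑f≤
... | no ¬⋈ with head f ≤? M
...   | yes x≤M = subst (∏ f ≤_) (∏-replicate (suc n) M) (∏-mono-≤ f≤M)
  where
  f≤M : ∀ i → f i ≤ M
  f≤M zero    = x≤M
  f≤M (suc j) = ≰⇒≥ (λ M≤gⱼ → ¬⋈ (j , inj₁ (x≤M , M≤gⱼ)))
...   | no x≰M = contradiction ∑f≤ (<⇒≱ (+-mono-<-≤ (≰⇒> x≰M) n*M≤∑))
  where
  n*M≤∑ : n * M ≤ ∑ (tail f)
  n*M≤∑ = subst (_≤ ∑ (tail f)) (∑-replicate n M)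
            (∑-mono-≤ (λ j → ≰⇒≥ (λ gⱼ≤M → ¬⋈ (j , inj₂ (gⱼ≤M , <⇒≤ (≰⇒> x≰M))))))

n^n*∏≤∑^n : ∀ {n} (r : Vector ℕ n) → n ^ n * ∏ r ≤ ∑ r ^ n
n^n*∏≤∑^n {n} r = begin
  n ^ n * ∏ r             ≡⟨ cong (_* ∏ r) (∏-replicate n n) ⟨
  ∏ (replicate n n) * ∏ r ≡⟨ ∏-distrib-* (replicate n n) r ⟨
  ∏ (λ a → n * r a)       ≤⟨ am-gm (λ a → n * r a) (∑ r) (≤-reflexive (sym (*-distribˡ-sum n r))) ⟩
  ∑ r ^ n                 ∎
  where open ≤-Reasoning

sum-tabulate : ∀ {n} (f : Vector ℕ n) → List.sum (tabulate f) ≡ ∑ f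
sum-tabulate {zero}  f = refl
sum-tabulate {suc n} f = cong (f zero +_) (sum-tabulate (tail f))

sum-map-allFin : ∀ {n} (f : Vector ℕ n) → List.sum (map f (allFin n)) ≡ ∑ f
sum-map-allFin f = trans (cong List.sum (map-tabulate id f)) (sum-tabulate f)

sum-map-concatMap : ∀ {A B : Set} (h : B → ℕ) (g : A → List B) xs →
                    List.sum (map h (concatMap g xs)) ≡ List.sum (map (List.sum ∘ map h ∘ g) xs)
sum-map-concatMap h g []       = refl
sum-map-concatMap h g (x ∷ xs) = begin
  List.sum (map h (g x ++ concatMap g xs))                   ≡⟨ cong List.sum (map-++ h (g x) _) ⟩
  List.sum (map h (g x) ++ map h (concatMap g xs))           ≡⟨ sum-++ (map h (g x)) _ ⟩
  List.sum (map h (g x)) + List.sum (map h (concatMap g xs)) ≡⟨ cong (_ +_) (sum-map-concatMap h g xs) ⟩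
  List.sum (map (List.sum ∘ map h ∘ g) (x ∷ xs))             ∎
  where open ≡-Reasoning

sum-map-∑ : ∀ {A : Set} {k} (H : A → Vector ℕ k) xs →
            List.sum (map (∑ ∘ H) xs) ≡ ∑[ c < k ] List.sum (map (λ x → H x c) xs)
sum-map-∑ {k = k} H []       = sym (sum-replicate-zero k)
sum-map-∑         H (x ∷ xs) = trans (cong (∑ (H x) +_) (sum-map-∑ H xs)) (sym (∑-distrib-+ (H x) _))

sum-map-*ˡ : ∀ {A : Set} a (h : A → ℕ) xs → List.sum (map (λ x → a * h x) xs) ≡ a * List.sum (map h xs)
sum-map-*ˡ a h []       = sym (*-zeroʳ a)
sum-map-*ˡ a h (x ∷ xs) = trans (cong (a * h x +_) (sum-map-*ˡ a h xs)) (sym (*-distribˡ-+ a (h x) _))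

length-filter≤sum-map : ∀ {A : Set} {P : A → Set} (P? : ∀ x → Dec (P x)) (w : A → ℕ) →
                        (∀ x → P x → 1 ≤ w x) → ∀ xs → length (filter P? xs) ≤ List.sum (map w xs)
length-filter≤sum-map P? w P⇒1≤w []       = z≤n
length-filter≤sum-map P? w P⇒1≤w (x ∷ xs) with P? x
... | yes Px = +-mono-≤ (P⇒1≤w x Px) (length-filter≤sum-map P? w P⇒1≤w xs)
... | no  _  = m≤n⇒m≤o+n (w x) (length-filter≤sum-map P? w P⇒1≤w xs)

sum-allFuns-suc : ∀ m k (h : (Fin (suc m) → Fin k) → ℕ) →
                  List.sum (map h (allFuns (suc m) k)) ≡
                  List.sum (map (λ f → ∑[ c < k ] h (cons c f)) (allFuns m k))
sum-allFuns-suc m k h =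
  trans (sum-map-concatMap h _ (allFuns m k))
        (cong List.sum (map-cong (λ f → trans (cong List.sum (sym (map-∘ (allFin k))))
                                              (sum-map-allFin (h ∘ (λ c → cons c f))))
                                 (allFuns m k)))

-- β sends each of the k columns to its block, U marks the columns already
-- used, and row i may only go to the blocks b with A i b.
module _ {k n} (β : Fin k → Fin n) where

  use : Vector Bool k → Fin k → Vector Bool k
  use U c = updateAt U c (const true)

  admissible : ∀ {m} → Vector Bool k → (Fin m → Fin n → Bool) → (Fin m → Fin k) → ℕ
  admissible {zero}  U A g = 1
  admissible {suc m} U A g =
    𝟙 (not (U (g zero))) * 𝟙 (A zero (β (g zero))) * admissible (use U (g zero)) (tail A) (tail g)

  count : ∀ m → Vector Bool k → (Fin m → Fin n → Bool) → ℕ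
  count m U A = List.sum (map (admissible U A) (allFuns m k))

  free : Vector Bool k → Fin n → ℕ
  free U b = ∑[ c < k ] (δ (β c) b * 𝟙 (not (U c)))

  admissible≡1 : ∀ {m} {U A} (g : Fin m → Fin k) → (∀ i j → g i ≡ g j → i ≡ j) →
                 (∀ i → U (g i) ≡ false) → (∀ i → A i (β (g i)) ≡ true) → admissible U A g ≡ 1
  admissible≡1 {zero}          g _   _     _       = refl
  admissible≡1 {suc m} {U} {A} g inj fresh allowed rewrite fresh zero | allowed zero =
    trans (+-identityʳ _) (admissible≡1 (tail g) inj′ fresh′ (allowed ∘ suc))
    where
    inj′ : ∀ i j → tail g i ≡ tail g j → i ≡ j
    inj′ i j gᵢ≡gⱼ = suc-injective (inj (suc i) (suc j) gᵢ≡gⱼ)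
    fresh′ : ∀ i → use U (g zero) (tail g i) ≡ false
    fresh′ i = trans (updateAt-minimal _ _ U (λ gᵢ≡g₀ → contradiction (inj (suc i) zero gᵢ≡g₀) λ ()))
                     (fresh (suc i))

  free-use : ∀ U c b → U c ≡ false → free (use U c) b + δ (β c) b ≡ free U b
  free-use U c b Uc≡false = begin
    free (use U c) b + δ (β c) b                 ≡⟨ cong (free (use U c) b +_) (*-identityʳ _) ⟨
    free (use U c) b + δ (β c) b * 1             ≡⟨ cong (λ u → free (use U c) b + δ (β c) b * 𝟙 (not u)) Uc≡false ⟨
    free (use U c) b + δ (β c) b * 𝟙 (not (U c)) ≡⟨ ∑-exchange c agree ⟩
    δ (β c) b * 𝟙 (not (use U c c)) + free U b   ≡⟨ cong (λ u → δ (β c) b * 𝟙 (not u) + free U b) (updateAt-updates c U) ⟩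
    δ (β c) b * 0 + free U b                     ≡⟨ cong (_+ free U b) (*-zeroʳ (δ (β c) b)) ⟩
    free U b                                     ∎
    where
    open ≡-Reasoning
    agree : ∀ c′ → c′ ≢ c → δ (β c′) b * 𝟙 (not (use U c c′)) ≡ δ (β c′) b * 𝟙 (not (U c′))
    agree c′ c′≢c = cong (λ u → δ (β c′) b * 𝟙 (not u)) (updateAt-minimal c′ c U c′≢c)

  free-use≤decrementAt : ∀ {U c} (cap : Vector ℕ n) → U c ≡ false → (∀ b → free U b ≤ cap b) →
                         ∀ b → free (use U c) b ≤ decrementAt cap (β c) b
  free-use≤decrementAt {U} {c} cap Uc≡false free≤cap b = begin
    free (use U c) b                         ≡⟨ m+n∸n≡m _ (δ (β c) b) ⟨
    free (use U c) b + δ (β c) b ∸ δ (β c) b ≡⟨ cong (_∸ δ (β c) b) (free-use U c b Uc≡false) ⟩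
    free U b ∸ δ (β c) b                     ≤⟨ ∸-monoˡ-≤ (δ (β c) b) (free≤cap b) ⟩
    decrementAt cap (β c) b                  ∎
    where open ≤-Reasoning

  count-suc : ∀ m U A → count (suc m) U A ≡
              ∑[ c < k ] (𝟙 (not (U c)) * 𝟙 (A zero (β c)) * count m (use U c) (tail A))
  count-suc m U A = begin
    count (suc m) U A
      ≡⟨ sum-allFuns-suc m k (admissible U A) ⟩
    List.sum (map (λ f → ∑[ c < k ] (a c * admissible (use U c) (tail A) f)) (allFuns m k))
      ≡⟨ sum-map-∑ (λ f c → a c * admissible (use U c) (tail A) f) (allFuns m k) ⟩
    ∑[ c < k ] List.sum (map (λ f → a c * admissible (use U c) (tail A) f) (allFuns m k))
      ≡⟨ ∑-cong (λ c → sum-map-*ˡ (a c) (admissible (use U c) (tail A)) (allFuns m k)) ⟩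
    ∑[ c < k ] (a c * count m (use U c) (tail A)) ∎
    where
    open ≡-Reasoning
    a : Fin k → ℕ
    a c = 𝟙 (not (U c)) * 𝟙 (A zero (β c))

  count≤∏cap!*∏∣A∣ : ∀ m U A (cap : Vector ℕ n) → (∀ b → free U b ≤ cap b) →
                     count m U A ≤ ∏ (_! ∘ cap) * ∏ (λ i → ∣ A i ∣)
  count≤∏cap!*∏∣A∣ zero U A cap _ = begin
    1                 ≡⟨ trans (∏-replicate n 1) (^-zeroˡ n) ⟨
    ∏ (replicate n 1) ≤⟨ ∏-mono-≤ (1≤n! ∘ cap) ⟩
    ∏ (_! ∘ cap)      ≡⟨ *-identityʳ _ ⟨
    ∏ (_! ∘ cap) * 1  ∎
    where open ≤-Reasoning
  count≤∏cap!*∏∣A∣ (suc m) U A cap free≤cap = begin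
    count (suc m) U A                        ≡⟨ count-suc m U A ⟩
    ∑[ c < k ] (𝟙 (not (U c)) * 𝟙 (A zero (β c)) * count m (use U c) (tail A))
                                             ≤⟨ ∑-mono-≤ place-first-row ⟩
    ∑[ c < k ] (𝟙 (not (U c)) * H (β c))     ≡⟨ ∑-fibre β (λ c → 𝟙 (not (U c))) H ⟩
    ∑[ b < n ] (H b * free U b)              ≤⟨ ∑-mono-≤ H*free≤ ⟩
    ∑[ b < n ] (𝟙 (A zero b) * (P * R))      ≡⟨ *-distribʳ-sum (P * R) (𝟙 ∘ A zero) ⟨
    ∣ A zero ∣ * (P * R)                     ≡⟨ x∙yz≈y∙xz ∣ A zero ∣ P R ⟩
    P * (∣ A zero ∣ * R)                     ∎
    where
    open ≤-Reasoning
    P = ∏ (_! ∘ cap)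
    R = ∏ (λ i → ∣ tail A i ∣)
    H : Fin n → ℕ
    H b = 𝟙 (A zero b) * (∏ (_! ∘ decrementAt cap b) * R)

    place-first-row : ∀ c → 𝟙 (not (U c)) * 𝟙 (A zero (β c)) * count m (use U c) (tail A) ≤
                            𝟙 (not (U c)) * H (β c)
    place-first-row c with U c in Uc≡
    ... | true  = z≤n
    ... | false = begin
      1 * 𝟙 (A zero (β c)) * count m (use U c) (tail A)   ≡⟨ *-assoc 1 (𝟙 (A zero (β c))) _ ⟩
      1 * (𝟙 (A zero (β c)) * count m (use U c) (tail A)) ≤⟨ *-monoʳ-≤ 1 (*-monoʳ-≤ (𝟙 (A zero (β c))) IH) ⟩
      1 * H (β c)                                         ∎
      where
      IH = count≤∏cap!*∏∣A∣ m (use U c) (tail A) (decrementAt cap (β c))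
                            (free-use≤decrementAt cap Uc≡ free≤cap)

    H*free≤ : ∀ b → H b * free U b ≤ 𝟙 (A zero b) * (P * R)
    H*free≤ b = begin
      H b * free U b                 ≤⟨ *-monoʳ-≤ (H b) (free≤cap b) ⟩
      𝟙 (A zero b) * (G * R) * cap b ≡⟨ trans (*-assoc (𝟙 (A zero b)) _ _)
                                              (cong (𝟙 (A zero b) *_) (xy∙z≈zx∙y G R (cap b))) ⟩
      𝟙 (A zero b) * (cap b * G * R) ≤⟨ *-monoʳ-≤ (𝟙 (A zero b)) (*-monoˡ-≤ R (*-∏!-decrementAt≤∏! cap b)) ⟩
      𝟙 (A zero b) * (P * R)         ∎
      where G = ∏ (_! ∘ decrementAt cap b)

free-∅≡t : ∀ t {n} b → free (quotient {n} t) (const false) b ≡ t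
free-∅≡t t {n} b = begin
  ∑[ c < n * t ] (δ (quotient t c) b * 1)  ≡⟨ ∑-quotient n t (λ a → δ a b * 1) ⟩
  ∑ (replicate t (∑[ a < n ] (δ a b * 1))) ≡⟨ cong (∑ ∘ replicate t) (∑-δˡ b (const 1)) ⟩
  ∑ (replicate t 1)                        ≡⟨ ∑-replicate t 1 ⟩
  t * 1                                    ≡⟨ *-identityʳ t ⟩
  t                                        ∎
  where open ≡-Reasoning

Lcount≤count : ∀ t n (B : Matrix01 n) →
               Lcount t n B ≤ count (quotient t) (n * t) (const false) (B ∘ quotient t)
Lcount≤count t n B =
  length-filter≤sum-map _ (admissible (quotient t) (const false) (B ∘ quotient t))
    (λ σ (σ-perm , σ-supported) →
      ≤-reflexive (sym (admissible≡1 (quotient t) σ σ-perm (λ _ → refl) σ-supported)))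
    (allFuns (n * t) (n * t))

Lcount≤t!^n*∏∣B∣^t : ∀ t n (B : Matrix01 n) → Lcount t n B ≤ (t !) ^ n * ∏ (∣_∣ ∘ B) ^ t
Lcount≤t!^n*∏∣B∣^t t n B = begin
  Lcount t n B                                              ≤⟨ Lcount≤count t n B ⟩
  count (quotient t) (n * t) (const false) (B ∘ quotient t) ≤⟨ count≤∏cap!*∏∣A∣ (quotient t) (n * t) (const false)
                                                                 (B ∘ quotient t) (const t) (≤-reflexive ∘ free-∅≡t t) ⟩
  ∏ (replicate n (t !)) * ∏ (∣_∣ ∘ B ∘ quotient t)          ≡⟨ cong₂ _*_ (∏-replicate n (t !))
                                                                 (trans (∏-quotient n t (∣_∣ ∘ B)) (∏-replicate t _)) ⟩
  (t !) ^ n * ∏ (∣_∣ ∘ B) ^ t                               ∎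
  where open ≤-Reasoning

ones≡∑∣B∣ : ∀ {n} (B : Matrix01 n) → ones B ≡ ∑ (∣_∣ ∘ B)
ones≡∑∣B∣ {n} B = trans (cong List.sum (map-cong (λ a → sum-map-allFin (𝟙 ∘ B a)) (allFin n)))
                        (sum-map-allFin (∣_∣ ∘ B))

proposition2p1 : (t n : ℕ) → 1 ≤ t → 1 ≤ n → (B : Matrix01 n) →
    Lcount t n B * n ^ (n * t) ≤ (t !) ^ n * ones B ^ (n * t)
proposition2p1 t n _ _ B = begin
  Lcount t n B * n ^ (n * t)        ≤⟨ *-monoˡ-≤ (n ^ (n * t)) (Lcount≤t!^n*∏∣B∣^t t n B) ⟩
  (t !) ^ n * P ^ t * n ^ (n * t)   ≡⟨ *-assoc ((t !) ^ n) (P ^ t) _ ⟩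
  (t !) ^ n * (P ^ t * n ^ (n * t)) ≡⟨ cong ((t !) ^ n *_) (trans (*-comm (P ^ t) _)
                                         (cong (_* P ^ t) (sym (^-*-assoc n n t)))) ⟩
  (t !) ^ n * ((n ^ n) ^ t * P ^ t) ≡⟨ cong ((t !) ^ n *_) (^-distribʳ-* (n ^ n) P t) ⟨
  (t !) ^ n * (n ^ n * P) ^ t       ≤⟨ *-monoʳ-≤ ((t !) ^ n) (^-monoˡ-≤ t (n^n*∏≤∑^n (∣_∣ ∘ B))) ⟩
  (t !) ^ n * (∑ (∣_∣ ∘ B) ^ n) ^ t ≡⟨ cong ((t !) ^ n *_) (^-*-assoc _ n t) ⟩
  (t !) ^ n * ∑ (∣_∣ ∘ B) ^ (n * t) ≡⟨ cong (λ s → (t !) ^ n * s ^ (n * t)) (ones≡∑∣B∣ B) ⟨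
  (t !) ^ n * ones B ^ (n * t)      ∎
  where
  open ≤-Reasoning
  P = ∏ (∣_∣ ∘ B)
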